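{- Let $G=(V,E)$ be a finite simple undirected graph and $\mathrm{HL}'_2(G)$ its symmetric lift. Define an equivalence relation $\sim$ on the vertex set of $\mathrm{HL}'_2(G)$ by $(u,v)\sim(v,u)$ for each $\{u,v\}\in E$, and let $\mathrm{HL}'_2(G)/{\sim}$ be the quotient graph whose vertices are the equivalence classes, two classes being adjacent iff some representative of one is adjacent in $\mathrm{HL}'_2(G)$ to some representative of the other. Then $\mathrm{HL}'_2(G)/{\sim}\cong L(G)$, the line graph of $G$, via the canonical map $\{(u,v),(v,u)\}\mapsto\{u,v\}$.
   Context: Symmetric lift: $B_{\mathrm{HL}'}(G)$ is the bipartite graph on $V'\sqcup V''$ (two disjoint copies of $V$) with edges $u'v''$ and $v'u''$ for each $\{u,v\}\in E$, and $\mathrm{HL}'_2(G)=L(B_{\mathrm{HL}'}(G))$ is its line graph. Its vertices are identified with ordered pairs $(u,v)$, $\{u,v\}\in E$, and distinct $(u,v),(x,y)$ are adjacent iff $u=x$ or $v=y$. The line graph $L(G)$ has vertex set $E$, two edges adjacent iff they share an endpoint. -}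

module Defs where

open import Data.Nat using (ℕ)
open import Data.Fin using (Fin; _<_)
open import Data.Fin.Properties using (<-cmp)
open import Data.Product using (_×_; _,_; Σ; ∃)
open import Data.Sum using (_⊎_)
open import Data.Empty using (⊥; ⊥-elim)
open import Relation.Nullary using (¬_)
open import Relation.Binary.PropositionalEquality using (_≡_; refl)
open import Relation.Binary.Definitions using (tri<; tri≈; tri>)
open import Level using (0ℓ)
open import Function.Bundles using (_⇔_)

record Graph : Set₁ where
  field
    n     : ℕ
    Adj   : Fin n → Fin n → Set
    sym   : ∀ {u v} → Adj u v → Adj v u
    irrefl : ∀ {u} → ¬ Adj u u

module _ (G : Graph) where
  open Graph G

  -- Vertices of HL'_2(G): ordered pairs (u,v) with {u,v} ∈ E.
  record Arc : Set where
    constructor arc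
    field
      tl  : Fin n
      hd  : Fin n
      adj : Adj tl hd
  open Arc

  SameArc : Arc → Arc → Set
  SameArc a b = tl a ≡ tl b × hd a ≡ hd b

  -- Adjacency in HL'_2(G) = L(B_HL'(G)): distinct and (u = x or v = y).
  HLAdj : Arc → Arc → Set
  HLAdj a b = ¬ SameArc a b × (tl a ≡ tl b ⊎ hd a ≡ hd b)

  _∼_ : Arc → Arc → Set
  a ∼ b = SameArc a b ⊎ (tl a ≡ hd b × hd a ≡ tl b)

  -- Adjacency of classes [a],[b] in the quotient HL'_2(G)/∼:
  -- some representative of [a] is adjacent to some representative of [b].
  QAdj : Arc → Arc → Set
  QAdj a b = Σ Arc λ a' → Σ Arc λ b' → a ∼ a' × b ∼ b' × HLAdj a' b'

  -- Vertices of L(G): edges {u,v} ∈ E, represented canonically as (lo,hi) with lo < hi.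
  record Edge : Set where
    constructor edge
    field
      lo   : Fin n
      hi   : Fin n
      lo<hi : lo < hi
      adj  : Adj lo hi
  open Edge

  SameEdge : Edge → Edge → Set
  SameEdge e f = lo e ≡ lo f × hi e ≡ hi f

  LAdj : Edge → Edge → Set
  LAdj e f = ¬ SameEdge e f ×
    (lo e ≡ lo f ⊎ lo e ≡ hi f ⊎ hi e ≡ lo f ⊎ hi e ≡ hi f)

  canon : Arc → Edge
  canon (arc u v a) with <-cmp u v
  ... | tri< u<v _ _ = edge u v u<v a
  ... | tri≈ _ refl _ = ⊥-elim (irrefl a)
  ... | tri> _ _ v<u = edge v u v<u (sym a)

  IsQuotientIso : Set
  IsQuotientIso =
      (∀ a b → a ∼ b → SameEdge (canon a) (canon b))
    × (∀ a b → SameEdge (canon a) (canon b) → a ∼ b)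
    × (∀ e → ∃ λ a → SameEdge (canon a) e)
    × (∀ a b → QAdj a b ⇔ LAdj (canon a) (canon b))

-- An edge {u,v} of G is named by exactly two arcs, (u,v) and (v,u), so the
-- canonical map identifies ∼-classes with edges. A common endpoint w of two
-- distinct edges gives adjacent representatives (both oriented away from w);
-- conversely a shared tail or head of two adjacent arcs is a common endpoint
-- of their edges, which differ because G has no loops.
module Submission where

open import Defs
open import Data.Fin using (Fin; _<_)
open import Data.Fin.Properties using (<-asym; <-cmp)
open import Data.Product using (_×_; _,_; Σ; ∃)
open import Data.Sum using (_⊎_; inj₁; inj₂)
open import Data.Empty using (⊥-elim)
open import Relation.Nullary using (¬_)
open import Relation.Binary.PropositionalEquality using (_≡_; refl; sym; trans)
open import Relation.Binary.Definitions using (tri<; tri≈; tri>)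
open import Function.Bundles using (_⇔_; mk⇔; Equivalence)

module QuotientOfSymmetricLift (G : Graph) where
  open Graph G renaming (sym to Adj-sym)
  open Arc {G}
  open Edge {G}

  _≈_ : Edge G → Edge G → Set
  _≈_ = SameEdge G

  ≈-sym : ∀ e f → e ≈ f → f ≈ e
  ≈-sym _ _ (p , q) = sym p , sym q

  ≈-trans : ∀ e f g → e ≈ f → f ≈ g → e ≈ g
  ≈-trans _ _ _ (p , q) (r , s) = trans p r , trans q s

  data Joins (e : Edge G) (x y : Fin n) : Set where
    forwards  : lo e ≡ x → hi e ≡ y → Joins e x y
    backwards : lo e ≡ y → hi e ≡ x → Joins e x y

  Joins-swap : ∀ {e x y} → Joins e x y → Joins e y x
  Joins-swap (forwards p q)  = backwards p q
  Joins-swap (backwards p q) = forwards p q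

  Joins-resp-≈ : ∀ {e f x y} → e ≈ f → Joins e x y → Joins f x y
  Joins-resp-≈ (l , h) (forwards p q)  = forwards (trans (sym l) p) (trans (sym h) q)
  Joins-resp-≈ (l , h) (backwards p q) = backwards (trans (sym l) p) (trans (sym h) q)

  lo<hi-at : ∀ e {x y} → lo e ≡ x → hi e ≡ y → x < y
  lo<hi-at e refl refl = lo<hi e

  Joins-unique : ∀ {e f x y} → Joins e x y → Joins f x y → e ≈ f
  Joins-unique (forwards p q)  (forwards r s)  = trans p (sym r) , trans q (sym s)
  Joins-unique (backwards p q) (backwards r s) = trans p (sym r) , trans q (sym s)
  Joins-unique {e} {f} (forwards p q) (backwards r s) =
    ⊥-elim (<-asym (lo<hi-at e p q) (lo<hi-at f r s))
  Joins-unique {e} {f} (backwards p q) (forwards r s) =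
    ⊥-elim (<-asym (lo<hi-at e p q) (lo<hi-at f r s))

  Joins-endpoints : ∀ {e x y x′ y′} → Joins e x y → Joins e x′ y′ →
                    (x ≡ x′ × y ≡ y′) ⊎ (x ≡ y′ × y ≡ x′)
  Joins-endpoints (forwards p q)  (forwards r s)  = inj₁ (trans (sym p) r , trans (sym q) s)
  Joins-endpoints (forwards p q)  (backwards r s) = inj₂ (trans (sym p) r , trans (sym q) s)
  Joins-endpoints (backwards p q) (forwards r s)  = inj₂ (trans (sym q) s , trans (sym p) r)
  Joins-endpoints (backwards p q) (backwards r s) = inj₁ (trans (sym q) s , trans (sym p) r)

  canon-Joins : ∀ a → Joins (canon G a) (tl a) (hd a)
  canon-Joins (arc u v a) with <-cmp u v
  ... | tri< _ _ _    = forwards refl refl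
  ... | tri≈ _ refl _ = ⊥-elim (irrefl a)
  ... | tri> _ _ _    = backwards refl refl

  ∼⇒≈ : ∀ a b → _∼_ G a b → canon G a ≈ canon G b
  ∼⇒≈ a b (inj₁ (refl , refl)) = Joins-unique (canon-Joins a) (canon-Joins b)
  ∼⇒≈ a b (inj₂ (refl , refl)) = Joins-unique (Joins-swap (canon-Joins a)) (canon-Joins b)

  ≈⇒∼ : ∀ a b → canon G a ≈ canon G b → _∼_ G a b
  ≈⇒∼ a b a≈b = Joins-endpoints (Joins-resp-≈ a≈b (canon-Joins a)) (canon-Joins b)

  forwardArc backwardArc : Edge G → Arc G
  forwardArc  e = arc (lo e) (hi e) (adj e)
  backwardArc e = arc (hi e) (lo e) (Adj-sym (adj e))

  canon-forwardArc : ∀ e → canon G (forwardArc e) ≈ e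
  canon-forwardArc e = Joins-unique (canon-Joins (forwardArc e)) (forwards {e} refl refl)

  canon-backwardArc : ∀ e → canon G (backwardArc e) ≈ e
  canon-backwardArc e = Joins-unique (canon-Joins (backwardArc e)) (backwards {e} refl refl)

  canon-surjective : ∀ e → ∃ λ a → canon G a ≈ e
  canon-surjective e = forwardArc e , canon-forwardArc e

  Endpoint : Edge G → Fin n → Set
  Endpoint e w = lo e ≡ w ⊎ hi e ≡ w

  CommonEndpoint : Edge G → Edge G → Set
  CommonEndpoint e f = ∃ λ w → Endpoint e w × Endpoint f w

  Joins⇒Endpointˡ : ∀ {e x y} → Joins e x y → Endpoint e x
  Joins⇒Endpointˡ (forwards p _)  = inj₁ p
  Joins⇒Endpointˡ (backwards _ q) = inj₂ q

  Joins⇒Endpointʳ : ∀ {e x y} → Joins e x y → Endpoint e y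
  Joins⇒Endpointʳ j = Joins⇒Endpointˡ (Joins-swap j)

  LAdj⇔distinct×CommonEndpoint : ∀ e f → LAdj G e f ⇔ (¬ e ≈ f × CommonEndpoint e f)
  LAdj⇔distinct×CommonEndpoint e f =
    mk⇔ (λ (e≉f , s) → e≉f , common s) (λ (e≉f , c) → e≉f , shared c)
    where
    Shared : Set
    Shared = lo e ≡ lo f ⊎ lo e ≡ hi f ⊎ hi e ≡ lo f ⊎ hi e ≡ hi f

    common : Shared → CommonEndpoint e f
    common (inj₁ p)               = lo f , inj₁ p , inj₁ refl
    common (inj₂ (inj₁ p))        = hi f , inj₁ p , inj₂ refl
    common (inj₂ (inj₂ (inj₁ p))) = lo f , inj₂ p , inj₁ refl
    common (inj₂ (inj₂ (inj₂ p))) = hi f , inj₂ p , inj₂ refl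
    shared : CommonEndpoint e f → Shared
    shared (_ , inj₁ p , inj₁ q) = inj₁ (trans p (sym q))
    shared (_ , inj₁ p , inj₂ q) = inj₂ (inj₁ (trans p (sym q)))
    shared (_ , inj₂ p , inj₁ q) = inj₂ (inj₂ (inj₁ (trans p (sym q))))
    shared (_ , inj₂ p , inj₂ q) = inj₂ (inj₂ (inj₂ (trans p (sym q))))

  Endpoint-resp-≈ : ∀ e e′ {w} → e ≈ e′ → Endpoint e′ w → Endpoint e w
  Endpoint-resp-≈ _ _ (l , _) (inj₁ p) = inj₁ (trans l p)
  Endpoint-resp-≈ _ _ (_ , h) (inj₂ p) = inj₂ (trans h p)

  LAdj-resp-≈ : ∀ e e′ f f′ → e ≈ e′ → f ≈ f′ → LAdj G e′ f′ → LAdj G e f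
  LAdj-resp-≈ e e′ f f′ e≈e′ f≈f′ l with Equivalence.to (LAdj⇔distinct×CommonEndpoint e′ f′) l
  ... | e′≉f′ , w , we′ , wf′ =
    Equivalence.from (LAdj⇔distinct×CommonEndpoint e f)
      (e≉f , w , Endpoint-resp-≈ e e′ e≈e′ we′ , Endpoint-resp-≈ f f′ f≈f′ wf′)
    where
    e≉f : ¬ e ≈ f
    e≉f e≈f = e′≉f′ (≈-trans e′ e f′ (≈-sym e e′ e≈e′) (≈-trans e f f′ e≈f f≈f′))

  Adj-irrefl-≡ : ∀ {u v} → Adj u v → ¬ u ≡ v
  Adj-irrefl-≡ a refl = irrefl a

  -- Two arcs of one edge sharing their tail or head are equal: the reversed
  -- pairing would make that edge a loop.
  HLAdj⇒distinct : ∀ a b → HLAdj G a b → ¬ canon G a ≈ canon G b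
  HLAdj⇒distinct a b (a≢b , shared) a≈b with ≈⇒∼ a b a≈b | shared
  ... | inj₁ same     | _         = a≢b same
  ... | inj₂ (p , _)  | inj₁ t≡t  = Adj-irrefl-≡ (adj b) (trans (sym t≡t) p)
  ... | inj₂ (_ , q)  | inj₂ h≡h  = Adj-irrefl-≡ (adj b) (trans (sym q) h≡h)

  HLAdj⇒LAdj : ∀ a b → HLAdj G a b → LAdj G (canon G a) (canon G b)
  HLAdj⇒LAdj a b hl@(_ , shared) =
    Equivalence.from (LAdj⇔distinct×CommonEndpoint (canon G a) (canon G b))
      (HLAdj⇒distinct a b hl , common shared)
    where
    common : tl a ≡ tl b ⊎ hd a ≡ hd b → CommonEndpoint (canon G a) (canon G b)
    common (inj₁ refl) = tl a , Joins⇒Endpointˡ (canon-Joins a) , Joins⇒Endpointˡ (canon-Joins b)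
    common (inj₂ refl) = hd a , Joins⇒Endpointʳ (canon-Joins a) , Joins⇒Endpointʳ (canon-Joins b)

  QAdj⇒LAdj : ∀ a b → QAdj G a b → LAdj G (canon G a) (canon G b)
  QAdj⇒LAdj a b (a′ , b′ , a∼a′ , b∼b′ , hl) =
    LAdj-resp-≈ (canon G a) (canon G a′) (canon G b) (canon G b′)
      (∼⇒≈ a a′ a∼a′) (∼⇒≈ b b′ b∼b′) (HLAdj⇒LAdj a′ b′ hl)

  arcLeaving : ∀ e {w} → Endpoint e w → Σ (Arc G) λ a → tl a ≡ w × e ≈ canon G a
  arcLeaving e (inj₁ p) = forwardArc e  , p , ≈-sym (canon G (forwardArc e)) e (canon-forwardArc e)
  arcLeaving e (inj₂ p) = backwardArc e , p , ≈-sym (canon G (backwardArc e)) e (canon-backwardArc e)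

  LAdj⇒QAdj : ∀ a b → LAdj G (canon G a) (canon G b) → QAdj G a b
  LAdj⇒QAdj a b l
    with Equivalence.to (LAdj⇔distinct×CommonEndpoint (canon G a) (canon G b)) l
  ... | a≉b , w , wa , wb with arcLeaving (canon G a) wa | arcLeaving (canon G b) wb
  ... | a′ , tl≡w , a≈a′ | b′ , tl≡w′ , b≈b′ =
    a′ , b′ , ≈⇒∼ a a′ a≈a′ , ≈⇒∼ b b′ b≈b′ , distinct , inj₁ (trans tl≡w (sym tl≡w′))
    where
    distinct : ¬ SameArc G a′ b′
    distinct same = a≉b (≈-trans (canon G a) (canon G a′) (canon G b) a≈a′
      (≈-trans (canon G a′) (canon G b′) (canon G b) (∼⇒≈ a′ b′ (inj₁ same))
        (≈-sym (canon G b) (canon G b′) b≈b′)))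

mainTheorem12 : (G : Graph) → IsQuotientIso G
mainTheorem12 G =
  ∼⇒≈ , ≈⇒∼ , canon-surjective , λ a b → mk⇔ (QAdj⇒LAdj a b) (LAdj⇒QAdj a b)
  where open QuotientOfSymmetricLift G
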